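{- Let $G$ be a connected graph with distinct vertices $u$ and $v$ such that $t(u)=t(v)$. Let $G'$ be the graph obtained from $G$ by twinning each of $u$ and $v$ to obtain new vertices $u'$ and $v'$, respectively. Then $\{\{u,u'\},\{v,v'\}\}$ is a set of co-transmission twins of $G'$.
   Context: All graphs are finite, simple, undirected. For a connected graph, $d(x,y)$ is the length of a shortest $x,y$-path and $t(x)=\sum_w d(x,w)$ is the transmission of $x$. Twinning a vertex $v$ means adding a new vertex $v'$ with $N(v')=N(v)$, where $N(\cdot)$ denotes the set of neighbors. Distinct vertices $x,y$ are twins if $N(x)=N(y)$. A set $\{\{v_1,v_2\},\{v_3,v_4\}\}$ is a set of co-transmission twins if $v_1,v_2$ are twins, $v_3,v_4$ are twins, and $t(v_1)=t(v_3)$. -}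

module Defs where

open import Data.Nat using (ℕ; zero; suc; _≤_; _+_)
open import Data.Fin using (Fin; zero; suc)
open import Data.Bool using (Bool; true; false)
open import Data.Product using (Σ; ∃; _×_; _,_)
open import Relation.Binary.PropositionalEquality using (_≡_; refl; _≢_)

record Graph (n : ℕ) : Set where
  field
    adj   : Fin n → Fin n → Bool
    sym   : ∀ x y → adj x y ≡ adj y x
    irrefl : ∀ x → adj x x ≡ false
open Graph public

data Walk {n : ℕ} (G : Graph n) : Fin n → Fin n → ℕ → Set where
  here : ∀ {x} → Walk G x x 0
  step : ∀ {x y z k} → adj G x y ≡ true → Walk G y z k → Walk G x z (suc k)

Connected : ∀ {n} → Graph n → Set
Connected G = ∀ x y → ∃ λ k → Walk G x y k

IsDistance : ∀ {n} → Graph n → Fin n → Fin n → ℕ → Set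
IsDistance G x y k = Walk G x y k × (∀ m → Walk G x y m → k ≤ m)

sumFin : ∀ {n} → (Fin n → ℕ) → ℕ
sumFin {zero}  f = 0
sumFin {suc n} f = f zero + sumFin (λ i → f (suc i))

HasTransmission : ∀ {n} → Graph n → Fin n → ℕ → Set
HasTransmission {n} G x T =
  Σ (Fin n → ℕ) λ d → (∀ w → IsDistance G x w (d w)) × (T ≡ sumFin d)

Twins : ∀ {n} → Graph n → Fin n → Fin n → Set
Twins G x y = x ≢ y × (∀ w → adj G x w ≡ adj G y w)

CoTransmissionTwins : ∀ {n} → Graph n → Fin n → Fin n → Fin n → Fin n → Set
CoTransmissionTwins G v1 v2 v3 v4 =
  Twins G v1 v2 × Twins G v3 v4 ×
  ∃ λ T → HasTransmission G v1 T × HasTransmission G v3 T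

-- Twinning v : new vertex is zero, old vertex a becomes suc a,
-- N(zero) = N(v) (as old vertices).
twinAdj : ∀ {n} → Graph n → Fin n → Fin (suc n) → Fin (suc n) → Bool
twinAdj G v zero    zero    = false
twinAdj G v zero    (suc b) = adj G v b
twinAdj G v (suc a) zero    = adj G a v
twinAdj G v (suc a) (suc b) = adj G a b

twinSym : ∀ {n} (G : Graph n) v x y → twinAdj G v x y ≡ twinAdj G v y x
twinSym G v zero    zero    = refl
twinSym G v zero    (suc b) = sym G v b
twinSym G v (suc a) zero    = sym G a v
twinSym G v (suc a) (suc b) = sym G a b

twinIrrefl : ∀ {n} (G : Graph n) v x → twinAdj G v x x ≡ false
twinIrrefl G v zero    = refl
twinIrrefl G v (suc a) = irrefl G a

twin : ∀ {n} → Graph n → Fin n → Graph (suc n)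
twin G v = record { adj = twinAdj G v ; sym = twinSym G v ; irrefl = twinIrrefl G v }

-- In G' every shortest path can be pushed down to G by identifying each twin with its
-- original, and every walk of G lifts back, so twinning changes no distance between old
-- vertices. Hence t'(u) = t(u) + d(u,v) + d(u,u') = t(u) + d(u,v) + 2, and symmetrically
-- t'(v) = t(v) + d(v,u) + 2; the two agree because d is symmetric. That d(u,u') = 2 needs
-- u to have a neighbour, which holds since G is connected and u ≠ v.
module Submission where

open import Defs
open import Data.Nat using (ℕ; suc; _≤_; _+_; z≤n; s≤s)
open import Data.Nat.Properties using (≤-antisym; +-suc)
open import Data.Fin using (Fin; zero; suc)
open import Data.Fin.Properties using (suc-injective)
open import Data.Bool using (true)
open import Data.Empty using (⊥-elim)
open import Data.Product using (∃; _×_; _,_; proj₂)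
open import Function using (_∘_)
open import Relation.Binary.PropositionalEquality
  using (_≡_; _≢_; refl; trans; cong; subst)
  renaming (sym to ≡-sym)

HasNeighbour : ∀ {n} → Graph n → Fin n → Set
HasNeighbour G x = ∃ λ y → adj G x y ≡ true

module _ {n} {G : Graph n} where

  walk-snoc : ∀ {x y z k} → Walk G x y k → adj G y z ≡ true → Walk G x z (suc k)
  walk-snoc here       q = step q here
  walk-snoc (step p w) q = step p (walk-snoc w q)

  walk-reverse : ∀ {x y k} → Walk G x y k → Walk G y x k
  walk-reverse here                       = here
  walk-reverse (step {x = x} {y = y} p w) = walk-snoc (walk-reverse w) (trans (Graph.sym G y x) p)

  isDistance-sym : ∀ {x y k m} → IsDistance G x y k → IsDistance G y x m → k ≡ m
  isDistance-sym (wk , mink) (wm , minm) =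
    ≤-antisym (mink _ (walk-reverse wm)) (minm _ (walk-reverse wk))

  walk⇒hasNeighbour : ∀ {x y k} → x ≢ y → Walk G x y k → HasNeighbour G x
  walk⇒hasNeighbour x≢y here       = ⊥-elim (x≢y refl)
  walk⇒hasNeighbour x≢y (step p _) = _ , p

module _ {n} (G : Graph n) (w : Fin n) where

  private
    G⁺ : Graph (suc n)
    G⁺ = twin G w

  untwin : Fin (suc n) → Fin n
  untwin zero    = w
  untwin (suc a) = a

  untwin-adj : ∀ x y → adj G⁺ x y ≡ true → adj G (untwin x) (untwin y) ≡ true
  untwin-adj zero    zero    ()
  untwin-adj zero    (suc b) p = p
  untwin-adj (suc a) zero    p = p
  untwin-adj (suc a) (suc b) p = p

  untwin-walk : ∀ {x y k} → Walk G⁺ x y k → Walk G (untwin x) (untwin y) k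
  untwin-walk here                          = here
  untwin-walk (step {x = x} {y = y} p walk) = step (untwin-adj x y p) (untwin-walk walk)

  suc-walk : ∀ {a b k} → Walk G a b k → Walk G⁺ (suc a) (suc b) k
  suc-walk here          = here
  suc-walk (step p rest) = step p (suc-walk rest)

  walk-to-twin : ∀ {a k} → Walk G a w (suc k) → Walk G⁺ (suc a) zero (suc k)
  walk-to-twin (step p here)       = step p here
  walk-to-twin (step p (step q r)) = step p (walk-to-twin (step q r))

  twin-isDistance-suc : ∀ {a b k} → IsDistance G a b k → IsDistance G⁺ (suc a) (suc b) k
  twin-isDistance-suc (walk , minimal) = suc-walk walk , λ m → minimal m ∘ untwin-walk

  twin-isDistance-new : ∀ {a k} → a ≢ w → IsDistance G a w k → IsDistance G⁺ (suc a) zero k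
  twin-isDistance-new a≢w (here , _)            = ⊥-elim (a≢w refl)
  twin-isDistance-new a≢w (step p walk , minimal) =
    walk-to-twin (step p walk) , λ m → minimal m ∘ untwin-walk

  twin-isDistance-own : HasNeighbour G w → IsDistance G⁺ (suc w) zero 2
  twin-isDistance-own (z , w~z) =
    step {y = suc z} w~z (step (trans (Graph.sym G z w) w~z) here) , atLeast2
    where
    atLeast2 : ∀ m → Walk G⁺ (suc w) zero m → 2 ≤ m
    atLeast2 _ (step p here) with trans (≡-sym p) (irrefl G w)
    ... | ()
    atLeast2 _ (step _ (step _ _)) = s≤s (s≤s z≤n)

  twin-hasTransmission : ∀ {a T k} → HasTransmission G a T → IsDistance G⁺ (suc a) zero k →
                         HasTransmission G⁺ (suc a) (k + T)
  twin-hasTransmission {k = k} (d , isDist , refl) toTwin = d⁺ , isDist⁺ , refl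
    where
    d⁺ : Fin (suc n) → ℕ
    d⁺ zero    = k
    d⁺ (suc b) = d b
    isDist⁺ : ∀ y → IsDistance G⁺ (suc _) y (d⁺ y)
    isDist⁺ zero    = toTwin
    isDist⁺ (suc b) = twin-isDistance-suc (isDist b)

  twin-twins : Twins G⁺ (suc w) zero
  twin-twins = (λ ()) , λ { zero → irrefl G w ; (suc _) → refl }

  twin-hasNeighbour : ∀ {a} → HasNeighbour G a → HasNeighbour G⁺ (suc a)
  twin-hasNeighbour (b , p) = suc b , p

  twin-twins-suc : ∀ {a b} → Twins G a b → Twins G⁺ (suc a) (suc b)
  twin-twins-suc (a≢b , sameNbrs) =
    a≢b ∘ suc-injective , λ { zero → sameNbrs w ; (suc c) → sameNbrs c }

proposition3p4 : ∀ {n} (G : Graph n) (u v : Fin n) →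
    Connected G → u ≢ v →
    (∃ λ T → HasTransmission G u T × HasTransmission G v T) →
    CoTransmissionTwins (twin (twin G u) (suc v))
      (suc (suc u)) (suc zero) (suc (suc v)) zero
proposition3p4 G u v connected u≢v (T , tu@(du , isDu , _) , tv@(_ , isDv , _)) =
  twin-twins-suc H (suc v) (twin-twins G u) , twin-twins H (suc v) ,
  _ , tu′ , subst (HasTransmission G′ (suc (suc v))) 2+d+T≡d+2+T tv′
  where
  H : Graph (suc _)
  H = twin G u
  G′ : Graph (suc (suc _))
  G′ = twin H (suc v)
  v≢u : v ≢ u
  v≢u = u≢v ∘ ≡-sym
  tu′ : HasTransmission G′ (suc (suc u)) (du v + (2 + T))
  tu′ = twin-hasTransmission H (suc v)
          (twin-hasTransmission G u tu
            (twin-isDistance-own G u (walk⇒hasNeighbour u≢v (proj₂ (connected u v)))))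
          (twin-isDistance-new H (suc v) (u≢v ∘ suc-injective) (twin-isDistance-suc G u (isDu v)))
  tv′ : HasTransmission G′ (suc (suc v)) (2 + (du v + T))
  tv′ = twin-hasTransmission H (suc v)
          (subst (λ k → HasTransmission H (suc v) (k + T)) (isDistance-sym (isDv u) (isDu v))
            (twin-hasTransmission G u tv (twin-isDistance-new G u v≢u (isDv u))))
          (twin-isDistance-own H (suc v)
            (twin-hasNeighbour G u (walk⇒hasNeighbour v≢u (proj₂ (connected v u)))))
  2+d+T≡d+2+T : 2 + (du v + T) ≡ du v + (2 + T)
  2+d+T≡d+2+T = ≡-sym (trans (+-suc (du v) (suc T)) (cong suc (+-suc (du v) T)))
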